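{- Let $G$ be a graph such that every colouring of $E(G)$ with $3$ colours contains a monochromatic triangle, and let $c$ be a $3$-colouring of the edges of $G$. If for each of the three colours there is a monochromatic copy of $K_3$ in that colour under $c$, then $c$ contains a monochromatic copy of $K_3+K_2$.
   Context: All graphs are finite and simple. $K_3+K_2$ denotes the vertex-disjoint union of a triangle and an edge; a monochromatic copy is one all of whose edges have the same colour. -}

module Defs where

open import Data.Nat using (ℕ)
open import Data.Fin using (Fin)
open import Data.Bool using (Bool; T; false)
open import Data.Product using (Σ; _×_; ∃-syntax)
open import Relation.Binary.PropositionalEquality using (_≡_; _≢_)

record Graph : Set where
  field
    n     : ℕ
    adj   : Fin n → Fin n → Bool
    sym   : ∀ u v → adj u v ≡ adj v u
    loopless : ∀ v → adj v v ≡ false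

open Graph public

Edge : (G : Graph) → Fin (n G) → Fin (n G) → Set
Edge G u v = T (adj G u v)

-- An edge {u,v} gets one colour,
-- so the colouring is required to agree on (u,v) and (v,u).
-- (Edge G u v is a proposition, T of a Bool, so the colour cannot depend
-- on the proof of adjacency.)
record Colouring (G : Graph) (k : ℕ) : Set where
  field
    col     : (u v : Fin (n G)) → Edge G u v → Fin k
    col-sym : ∀ u v (e : Edge G u v) (e' : Edge G v u) → col u v e ≡ col v u e'

open Colouring public

MonoTriangleOf : {G : Graph} {k : ℕ} → Colouring G k → Fin k → Set
MonoTriangleOf {G} c i =
  ∃[ x ] ∃[ y ] ∃[ z ]
    ( x ≢ y × x ≢ z × y ≢ z
    × Σ (Edge G x y) (λ e → col c x y e ≡ i)
    × Σ (Edge G x z) (λ e → col c x z e ≡ i)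
    × Σ (Edge G y z) (λ e → col c y z e ≡ i) )

HasMonoTriangle : {G : Graph} {k : ℕ} → Colouring G k → Set
HasMonoTriangle {k = k} c = ∃[ i ] MonoTriangleOf c i

HasMonoK3K2 : {G : Graph} {k : ℕ} → Colouring G k → Set
HasMonoK3K2 {G} {k} c =
  ∃[ i ] ∃[ x ] ∃[ y ] ∃[ z ] ∃[ u ] ∃[ v ]
    ( x ≢ y × x ≢ z × x ≢ u × x ≢ v
    × y ≢ z × y ≢ u × y ≢ v
    × z ≢ u × z ≢ v
    × u ≢ v
    × Σ (Edge G x y) (λ e → col c x y e ≡ i)
    × Σ (Edge G x z) (λ e → col c x z e ≡ i)
    × Σ (Edge G y z) (λ e → col c y z e ≡ i)
    × Σ (Edge G u v) (λ e → col c u v e ≡ i) )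

-- Fix monochromatic triangles T₀, T₁, T₂ of the three colours; together they have at most
-- nine vertices.  Label each vertex by its position among these nine, or by 0 if it lies on
-- none of them, and colour an edge uv of G by the colour of the pair of labels in a
-- triangle-free 3-colouring of K₁₀ (two Greenwood–Gleason pentagons joined by a complete
-- bipartite graph in the third colour).  This colouring of G has a monochromatic triangle,
-- which must therefore contain an edge uv whose ends have equal labels.  Distinct vertices on
-- the triangles have distinct labels, so u and v avoid all of T₀, T₁, T₂; if uv has colour i
-- under the original colouring, then T_i together with uv is a monochromatic K₃ + K₂.
module Submission where

open import Defs hiding (sym)
open import Data.Nat using (ℕ; _+_; _*_; _∸_; _%_)
open import Data.Fin using (Fin; zero; suc; toℕ; _≟_; splitAt; combine; remQuot)
open import Data.Fin.Properties using (all?; any?; remQuot-combine)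
open import Data.Product using (_×_; _,_; uncurry; ∃-syntax)
open import Data.Sum using (_⊎_; inj₁; inj₂)
open import Data.Empty using (⊥-elim)
open import Function using (_∘_)
open import Relation.Nullary using (¬_; Dec; yes; no; ¬?)
open import Relation.Nullary.Decidable using (_×-dec_; toWitness)
open import Relation.Binary.Definitions using (DecidableEquality)
open import Relation.Binary.PropositionalEquality using (_≡_; _≢_; refl; sym; trans; cong)

MonochromaticTriangle : ∀ {m k} → (Fin m → Fin m → Fin k) → Fin m → Fin m → Fin m → Set
MonochromaticTriangle K p q r = p ≢ q × p ≢ r × q ≢ r × K p q ≡ K p r × K p q ≡ K q r

monochromaticTriangle? : ∀ {m k} (K : Fin m → Fin m → Fin k) p q r →
                         Dec (MonochromaticTriangle K p q r)
monochromaticTriangle? K p q r =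
  ¬? (p ≟ q) ×-dec ¬? (p ≟ r) ×-dec ¬? (q ≟ r) ×-dec (K p q ≟ K p r) ×-dec (K p q ≟ K q r)

TriangleFree : ∀ {m k} → (Fin m → Fin m → Fin k) → Set
TriangleFree K = ∀ p q r → ¬ MonochromaticTriangle K p q r

triangleFree? : ∀ {m k} (K : Fin m → Fin m → Fin k) → Dec (TriangleFree K)
triangleFree? K = all? λ p → all? λ q → all? λ r → ¬? (monochromaticTriangle? K p q r)

Symmetric : ∀ {m k} → (Fin m → Fin m → Fin k) → Set
Symmetric K = ∀ p q → K p q ≡ K q p

symmetric? : ∀ {m k} (K : Fin m → Fin m → Fin k) → Dec (Symmetric K)
symmetric? K = all? λ p → all? λ q → K p q ≟ K q p

pentagon : Fin 5 → Fin 5 → Fin 3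
pentagon a b with (5 + toℕ a ∸ toℕ b) % 5
... | 1 = zero
... | 4 = zero
... | _ = suc zero

twoPentagons : Fin 10 → Fin 10 → Fin 3
twoPentagons p q with splitAt 5 p | splitAt 5 q
... | inj₁ a | inj₁ b = pentagon a b
... | inj₂ a | inj₂ b = pentagon a b
... | _      | _      = suc (suc zero)

twoPentagons-symmetric : Symmetric twoPentagons
twoPentagons-symmetric = toWitness {a? = symmetric? twoPentagons} _

twoPentagons-triangleFree : TriangleFree twoPentagons
twoPentagons-triangleFree = toWitness {a? = triangleFree? twoPentagons} _

pullback : ∀ {m k} (G : Graph) (K : Fin m → Fin m → Fin k) → Symmetric K →
           (Fin (n G) → Fin m) → Colouring G k
pullback G K K-sym f = record
  { col     = λ u v _ → K (f u) (f v)
  ; col-sym = λ u v _ _ → K-sym (f u) (f v)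
  }

ramsey⇒edgeWithEqualLabels :
  ∀ {m k} (G : Graph) → ((d : Colouring G k) → HasMonoTriangle d) →
  (K : Fin m → Fin m → Fin k) (K-sym : Symmetric K) → TriangleFree K →
  (f : Fin (n G) → Fin m) → ∃[ u ] ∃[ v ] (u ≢ v × Edge G u v × f u ≡ f v)
ramsey⇒edgeWithEqualLabels G ramsey K K-sym K-free f
  with ramsey (pullback G K K-sym f)
... | _ , x , y , z , x≢y , x≢z , y≢z , (exy , Kxy) , (exz , Kxz) , (eyz , Kyz)
  with f x ≟ f y | f x ≟ f z | f y ≟ f z
... | yes fx≡fy | _         | _         = x , y , x≢y , exy , fx≡fy
... | no _      | yes fx≡fz | _         = x , z , x≢z , exz , fx≡fz
... | no _      | no _      | yes fy≡fz = y , z , y≢z , eyz , fy≡fz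
... | no fx≢fy  | no fx≢fz  | no fy≢fz  = ⊥-elim (K-free (f x) (f y) (f z)
      (fx≢fy , fx≢fz , fy≢fz , trans Kxy (sym Kxz) , trans Kxy (sym Kyz)))

module _ {a} {A : Set a} (_≟ᴬ_ : DecidableEquality A) {m : ℕ} (L : Fin m → A) where

  position : A → Fin (1 + m)
  position u with any? (λ k → L k ≟ᴬ u)
  ... | yes (k , _) = suc k
  ... | no _        = zero

  position-suc : ∀ {u k} → position u ≡ suc k → L k ≡ u
  position-suc {u} eq with any? (λ k → L k ≟ᴬ u)
  position-suc refl | yes (_ , Lk≡u) = Lk≡u

  position-zero : ∀ {u} → position u ≡ zero → ∀ k → L k ≢ u
  position-zero {u} eq k Lk≡u with any? (λ k → L k ≟ᴬ u)
  ... | no ∄k = ∄k (k , Lk≡u)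

  equalPositions⇒equal⊎absent : ∀ {u v} → position u ≡ position v →
                                u ≡ v ⊎ ((∀ k → L k ≢ u) × (∀ k → L k ≢ v))
  equalPositions⇒equal⊎absent {u} {v} eq with position u in eqᵘ
  ... | suc k = inj₁ (trans (sym (position-suc eqᵘ)) (position-suc (sym eq)))
  ... | zero  = inj₂ (position-zero eqᵘ , position-zero (sym eq))

module _ {G : Graph} {k : ℕ} (c : Colouring G k) where

  corner : ∀ {i} → MonoTriangleOf c i → Fin 3 → Fin (n G)
  corner (x , _ , _ , _) zero             = x
  corner (_ , y , _ , _) (suc zero)       = y
  corner (_ , _ , z , _) (suc (suc zero)) = z

  triangle+disjointEdge⇒K3K2 :
    ∀ {i u v} (t : MonoTriangleOf c i) → u ≢ v → (e : Edge G u v) → col c u v e ≡ i →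
    (∀ j → corner t j ≢ u) → (∀ j → corner t j ≢ v) → HasMonoK3K2 c
  triangle+disjointEdge⇒K3K2 {i} {u} {v}
    (x , y , z , x≢y , x≢z , y≢z , xy , xz , yz) u≢v e cuv≡i t≢u t≢v =
    i , x , y , z , u , v ,
    x≢y , x≢z , t≢u zero , t≢v zero ,
    y≢z , t≢u (suc zero) , t≢v (suc zero) ,
    t≢u (suc (suc zero)) , t≢v (suc (suc zero)) ,
    u≢v , xy , xz , yz , (e , cuv≡i)

module _ {G : Graph} {k : ℕ} (c : Colouring G k) (T : (i : Fin k) → MonoTriangleOf c i) where

  triangleCorner : Fin k → Fin 3 → Fin (n G)
  triangleCorner i = corner c (T i)

  allCorners : Fin (k * 3) → Fin (n G)
  allCorners = uncurry triangleCorner ∘ remQuot 3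

  equalCornerPositions⇒K3K2 : ∀ {u v} → u ≢ v → Edge G u v →
    position _≟_ allCorners u ≡ position _≟_ allCorners v → HasMonoK3K2 c
  equalCornerPositions⇒K3K2 {u} {v} u≢v e eq
    with equalPositions⇒equal⊎absent _≟_ allCorners eq
  ... | inj₁ u≡v       = ⊥-elim (u≢v u≡v)
  ... | inj₂ (u∉ , v∉) =
    triangle+disjointEdge⇒K3K2 c (T i) u≢v e refl (avoids u∉) (avoids v∉)
    where
    i = col c u v e
    avoids : ∀ {w} → (∀ k → allCorners k ≢ w) → ∀ j → triangleCorner i j ≢ w
    avoids w∉ j corner≡w =
      w∉ (combine i j) (trans (cong (uncurry triangleCorner) (remQuot-combine i j)) corner≡w)

mainTheorem11 : (G : Graph)
    → ((d : Colouring G 3) → HasMonoTriangle d)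
    → (c : Colouring G 3)
    → ((i : Fin 3) → MonoTriangleOf c i)
    → HasMonoK3K2 c
mainTheorem11 G ramsey c T =
  let u , v , u≢v , e , eq = ramsey⇒edgeWithEqualLabels G ramsey twoPentagons
                               twoPentagons-symmetric twoPentagons-triangleFree
                               (position _≟_ (allCorners c T))
  in equalCornerPositions⇒K3K2 c T u≢v e eq
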